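{- For any integer $m\ge2$, any set $V\subseteq[m]$ and any integer $n\ge2$, \[H_n(D^{(m,V)})=H^{(1)}_{n-1}(D^{(m,V-1)}).\]
   Context: For an integer $m\ge 2$ and $V\subseteq[m]=\{1,\dots,m\}$, let $(m,V)=\{k\in\mathbb{Z}^+ : k\equiv j \pmod m \text{ for some } j\in V\}$, and for an integer $t$ let $V+t=\{k\in[m]: k\equiv j+t \pmod m \text{ for some } j\in V\}$. A Dyck path of size $n$ is a lattice path from $(0,0)$ to $(2n,0)$ with steps $(1,1)$ and $(1,-1)$ never going below the $x$-axis; a peak is an up-step immediately followed by a down-step, and its height is the $y$-coordinate of the point between them. Let $d_n^{(m,V)}$ be the number of Dyck paths of size $n$ none of whose peaks has height in $(m,V)$, and $D^{(m,V)}(x)=\sum_{n\ge0}d_n^{(m,V)}x^n$. For a power series $F=\sum f_nx^n$, $n\ge1$, $k\ge0$: $H^{(k)}_n(F)=\det(f_{k+i+j})_{0\le i,j\le n-1}$ and $H_n(F)=H^{(0)}_n(F)$. -}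

module Defs where

open import Data.Bool using (Bool; true; false; _∧_; not)
open import Data.Nat using (ℕ; zero; suc; _+_; _∸_; _%_; NonZero; _≡ᵇ_; _≤ᵇ_)
open import Data.Fin using (Fin; toℕ; punchIn) renaming (zero to fzero; suc to fsuc)
open import Data.Vec using (Vec; lookup; tabulate)
open import Data.List using (List; []; _∷_; map; _++_; length; filterᵇ; allFin)
open import Data.Bool.ListAction using (any; all)
open import Data.Integer using (ℤ; +_; -_)
  renaming (_+_ to _+ℤ_; _*_ to _*ℤ_)

-- A subset V of [m] = {1,…,m}: position i (a Fin m) encodes the element toℕ i + 1.
Subset : ℕ → Set
Subset m = Vec Bool m

elt : {m : ℕ} → Fin m → ℕ
elt i = suc (toℕ i)

inModSet : (m : ℕ) .{{_ : NonZero m}} → Subset m → ℕ → Bool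
inModSet m V k = (1 ≤ᵇ k) ∧ any (λ j → lookup V j ∧ ((k % m) ≡ᵇ (elt j % m))) (allFin m)

-- V - 1 = {k ∈ [m] : k ≡ j - 1 (mod m) for some j ∈ V}, i.e. k + 1 ≡ j (mod m)
shiftDown : (m : ℕ) .{{_ : NonZero m}} → Subset m → Subset m
shiftDown m V = tabulate (λ k → any (λ j → lookup V j ∧ ((suc (elt k) % m) ≡ᵇ (elt j % m))) (allFin m))

-- lattice words: true = up-step (1,1), false = down-step (1,-1)
words : ℕ → List (List Bool)
words zero = [] ∷ []
words (suc k) = map (true ∷_) (words k) ++ map (false ∷_) (words k)

dyckFrom : ℕ → List Bool → Bool
dyckFrom zero [] = true
dyckFrom (suc h) [] = false
dyckFrom h (true ∷ s) = dyckFrom (suc h) s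
dyckFrom zero (false ∷ s) = false
dyckFrom (suc h) (false ∷ s) = dyckFrom h s

peakHeights : ℕ → List Bool → List ℕ
peakHeights h [] = []
peakHeights h (true ∷ []) = []
peakHeights h (true ∷ false ∷ s) = suc h ∷ peakHeights h s
peakHeights h (true ∷ true ∷ s) = peakHeights (suc h) (true ∷ s)
peakHeights h (false ∷ s) = peakHeights (h ∸ 1) s

dCount : (m : ℕ) .{{_ : NonZero m}} → Subset m → ℕ → ℕ
dCount m V n = length (filterᵇ (λ w → dyckFrom 0 w ∧ all (λ h → not (inModSet m V h)) (peakHeights 0 w)) (words (n + n)))

-- coefficient sequence of D^{(m,V)}(x)
D : (m : ℕ) .{{_ : NonZero m}} → Subset m → ℕ → ℤ
D m V n = + dCount m V n

sign : ℕ → ℤ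
sign zero = + 1
sign (suc k) = - sign k

sumFin : (n : ℕ) → (Fin n → ℤ) → ℤ
sumFin zero f = + 0
sumFin (suc n) f = f fzero +ℤ sumFin n (λ i → f (fsuc i))

det : (n : ℕ) → (Fin n → Fin n → ℤ) → ℤ
det zero A = + 1
det (suc n) A = sumFin (suc n) (λ j → sign (toℕ j) *ℤ (A fzero j *ℤ det n (λ r c → A (fsuc r) (punchIn j c))))

hankel : ℕ → ℕ → (ℕ → ℤ) → ℤ
hankel k n f = det n (λ i j → f (k + toℕ i + toℕ j))

-- Cutting a Dyck path at its returns to the axis gives d(N+1) = Σₖ a(k)·d(N−k), where a(k) counts the
-- admissible arches U P D with P of size k.  For k ≥ 1 the peaks of such an arch are those of P raised by
-- one, so a(k) is the number of paths of size k whose peak heights avoid (m,V) − 1 = (m,V−1).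
-- For any f with f(0) = 1 satisfying this recurrence, subtracting Σ_{s<r} a(r−1−s)·(row s) from every row r
-- of the Hankel matrix (f(i+j)) turns its first column into (1,0,…,0), and the complementary minor is,
-- after transposition, a unitriangular row transform of (a(1+i+j)).  Hence Hₙ(f) = H⁽¹⁾ₙ₋₁(a).

module Submission where

open import Defs
open import Data.Nat using (ℕ; _≤_; _∸_; NonZero)
open import Relation.Binary.PropositionalEquality using (_≡_)

open import Data.Bool using (Bool; true; false; if_then_else_; T; T?; not; _∧_; _∨_)
open import Data.Bool.ListAction using (any; all)
open import Data.Bool.Properties using (∧-zeroʳ; if-eta; T-≡; T-∧; ⇔→≡)
open import Data.Fin using (Fin; toℕ; punchIn; inject₁; fromℕ<) renaming (zero to fzero; suc to fsuc)
import Data.Fin.Properties as Finₚ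
open import Data.Integer as ℤ using (ℤ; 0ℤ; 1ℤ; -_; _+_; _*_)
import Data.Integer.Properties as ℤₚ
open import Data.Integer.Tactic.RingSolver using (solve-∀)
open import Algebra.Properties.Semiring.Sum ℤₚ.+-*-semiring
  using (sum; sum-cong-≗; sum-replicate-zero; ∑-distrib-+; ∑-comm; *-distribˡ-sum)
open import Data.List using (List; []; _∷_; map; _++_; length; filterᵇ; allFin)
open import Data.List.Membership.Propositional using (lose)
open import Data.List.Membership.Propositional.Properties using (∈-allFin)
open import Data.List.Properties using (length-++; filter-++; filter-≐; filter-none)
import Data.List.Relation.Unary.All as All
open import Data.List.Relation.Unary.Any using (satisfied)
open import Data.List.Relation.Unary.Any.Properties using (any⁺; any⁻)
open import Data.Nat as ℕ using (zero; suc; _<_; _<?_; _%_; _≡ᵇ_; s≤s; z≤n)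
open import Data.Nat.DivMod using (%-distribˡ-+; m%n<n; m%n%n≡m%n)
import Data.Nat.Properties as ℕₚ
open import Data.Product using (_,_; ∃)
open import Data.Unit using (tt)
open import Data.Vec using (lookup)
open import Data.Vec.Functional using (updateAt)
open import Data.Vec.Functional.Properties using (updateAt-updates; updateAt-minimal)
open import Data.Vec.Properties using (lookup∘tabulate)
open import Function using (_∘_; const)
open import Function.Bundles using (Equivalence; mk⇔)
open import Relation.Binary.Definitions using (tri<; tri≈; tri>)
open import Relation.Binary.PropositionalEquality
  using (_≢_; _≗_; refl; sym; trans; cong; cong₂; cong-app; subst; module ≡-Reasoning)
open import Relation.Nullary using (¬_; yes; no; contradiction)
open ≡-Reasoning

sumFin≡sum : ∀ n (f : Fin n → ℤ) → sumFin n f ≡ sum f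
sumFin≡sum zero    f = refl
sumFin≡sum (suc n) f = cong (f fzero +_) (sumFin≡sum n (f ∘ fsuc))

sum-zero : ∀ n {f : Fin n → ℤ} → (∀ i → f i ≡ 0ℤ) → sum f ≡ 0ℤ
sum-zero n f≗0 = trans (sum-cong-≗ f≗0) (sum-replicate-zero n)

sum-linear : ∀ {n} {f g h : Fin n → ℤ} (k : ℤ) → (∀ i → f i ≡ g i + k * h i) →
             sum f ≡ sum g + k * sum h
sum-linear {f = f} {g} {h} k eq = begin
  sum f                       ≡⟨ sum-cong-≗ eq ⟩
  sum (λ i → g i + k * h i)   ≡⟨ ∑-distrib-+ g _ ⟩
  sum g + sum (λ i → k * h i) ≡⟨ cong (sum g +_) (*-distribˡ-sum k h) ⟨
  sum g + k * sum h           ∎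

*-*-sum : ∀ {n} x y (g : Fin n → ℤ) → x * (y * sum g) ≡ sum (λ i → x * (y * g i))
*-*-sum x y g = trans (cong (x *_) (*-distribˡ-sum y g)) (*-distribˡ-sum x (λ i → y * g i))

Matrix : ℕ → Set
Matrix n = Fin n → Fin n → ℤ

_ᵀ : ∀ {n} → Matrix n → Matrix n
(X ᵀ) r c = X c r

minor : ∀ {n} → Fin (suc n) → Fin (suc n) → Matrix (suc n) → Matrix n
minor i j X r c = X (punchIn i r) (punchIn j c)

setRow : ∀ {n} → Fin n → (Fin n → ℤ) → Matrix n → Matrix n
setRow a v X = updateAt X a (const v)

setRow-same : ∀ {n} (a : Fin n) v (X : Matrix n) → setRow a v X a ≗ v
setRow-same a v X = cong-app (updateAt-updates a X)

setRow-other : ∀ {n} {a r : Fin n} v (X : Matrix n) → r ≢ a → setRow a v X r ≗ X r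
setRow-other {a = a} {r} v X r≢a = cong-app (updateAt-minimal r a X r≢a)

laplaceTerm : ∀ {n} → Matrix (suc n) → Fin (suc n) → ℤ
laplaceTerm {n} X j = sign (toℕ j) * (X fzero j * det n (minor fzero j X))

det-expandFirstRow : ∀ n (X : Matrix (suc n)) → det (suc n) X ≡ sum (laplaceTerm X)
det-expandFirstRow n X = sumFin≡sum (suc n) (laplaceTerm X)

det-cong : ∀ n {X Y : Matrix n} → (∀ r c → X r c ≡ Y r c) → det n X ≡ det n Y
det-cong zero    X≈Y = refl
det-cong (suc n) {X} {Y} X≈Y = begin
  det (suc n) X        ≡⟨ det-expandFirstRow n X ⟩
  sum (laplaceTerm X)  ≡⟨ sum-cong-≗ (λ j → cong₂ (λ x d → sign (toℕ j) * (x * d))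
                              (X≈Y fzero j) (det-cong n (λ r c → X≈Y (fsuc r) (punchIn j c)))) ⟩
  sum (laplaceTerm Y)  ≡⟨ det-expandFirstRow n Y ⟨
  det (suc n) Y        ∎

det-linearInRow : ∀ n (X Y Z : Matrix n) (a : Fin n) (k : ℤ) →
  (∀ r → r ≢ a → X r ≗ Y r) → (∀ r → r ≢ a → Z r ≗ Y r) →
  (∀ c → X a c ≡ Y a c + k * Z a c) → det n X ≡ det n Y + k * det n Z
det-linearInRow (suc n) X Y Z a k X≈Y Z≈Y Xa = begin
  det (suc n) X                                ≡⟨ det-expandFirstRow n X ⟩
  sum (laplaceTerm X)
    ≡⟨ sum-linear {g = laplaceTerm Y} {laplaceTerm Z} k (termwise a X≈Y Z≈Y Xa) ⟩
  sum (laplaceTerm Y) + k * sum (laplaceTerm Z) ≡⟨ cong₂ (λ y z → y + k * z)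
                                                     (det-expandFirstRow n Y) (det-expandFirstRow n Z) ⟨
  det (suc n) Y + k * det (suc n) Z            ∎
  where
  termwise : ∀ a → (∀ r → r ≢ a → X r ≗ Y r) → (∀ r → r ≢ a → Z r ≗ Y r) →
    (∀ c → X a c ≡ Y a c + k * Z a c) → ∀ j → laplaceTerm X j ≡ laplaceTerm Y j + k * laplaceTerm Z j
  termwise fzero X≈Y Z≈Y Xa j = begin
    s * (X fzero j * det n (minor fzero j X))
      ≡⟨ cong₂ (λ x d → s * (x * d)) (Xa j) (det-cong n (λ r c → X≈Y (fsuc r) (λ ()) _)) ⟩
    s * ((Y fzero j + k * Z fzero j) * dY)
      ≡⟨ distrib s (Y fzero j) (Z fzero j) k dY ⟩
    s * (Y fzero j * dY) + k * (s * (Z fzero j * dY))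
      ≡⟨ cong (λ d → s * (Y fzero j * dY) + k * (s * (Z fzero j * d)))
              (det-cong n (λ r c → Z≈Y (fsuc r) (λ ()) _)) ⟨
    laplaceTerm Y j + k * laplaceTerm Z j ∎
    where
    s : ℤ
    s = sign (toℕ j)
    dY : ℤ
    dY = det n (minor fzero j Y)
    distrib : ∀ s y z k d → s * ((y + k * z) * d) ≡ s * (y * d) + k * (s * (z * d))
    distrib = solve-∀
  termwise (fsuc a) X≈Y Z≈Y Xa j = begin
    s * (X fzero j * det n (minor fzero j X))
      ≡⟨ cong₂ (λ x d → s * (x * d)) (X≈Y fzero (λ ()) j) minorLinear ⟩
    s * (Y fzero j * (det n (minor fzero j Y) + k * det n (minor fzero j Z)))
      ≡⟨ distrib s (Y fzero j) k (det n (minor fzero j Y)) (det n (minor fzero j Z)) ⟩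
    s * (Y fzero j * det n (minor fzero j Y)) + k * (s * (Y fzero j * det n (minor fzero j Z)))
      ≡⟨ cong (λ z → laplaceTerm Y j + k * (s * (z * det n (minor fzero j Z)))) (Z≈Y fzero (λ ()) j) ⟨
    laplaceTerm Y j + k * laplaceTerm Z j ∎
    where
    s : ℤ
    s = sign (toℕ j)
    minorLinear : det n (minor fzero j X) ≡ det n (minor fzero j Y) + k * det n (minor fzero j Z)
    minorLinear = det-linearInRow n (minor fzero j X) (minor fzero j Y) (minor fzero j Z) a k
      (λ r r≢a c → X≈Y (fsuc r) (r≢a ∘ Finₚ.suc-injective) (punchIn j c))
      (λ r r≢a c → Z≈Y (fsuc r) (r≢a ∘ Finₚ.suc-injective) (punchIn j c))
      (λ c → Xa (punchIn j c))
    distrib : ∀ s y k d e → s * (y * (d + k * e)) ≡ s * (y * d) + k * (s * (y * e))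
    distrib = solve-∀

det-expandFirstColumn : ∀ n (X : Matrix (suc n)) →
  det (suc n) X ≡ sum (λ i → sign (toℕ i) * (X i fzero * det n (minor i fzero X)))
det-expandFirstColumn zero    X = refl
det-expandFirstColumn (suc n) X = cong (laplaceTerm X fzero +_) (begin
  sumFin (suc n) (laplaceTerm X ∘ fsuc)
    ≡⟨ sumFin≡sum (suc n) (laplaceTerm X ∘ fsuc) ⟩
  sum (λ j → - sign (toℕ j) * (a j * det (suc n) (minor fzero (fsuc j) X)))
    ≡⟨ sum-cong-≗ (λ j → trans (cong (λ d → - sign (toℕ j) * (a j * d))
                                     (det-expandFirstColumn n (minor fzero (fsuc j) X)))
                               (*-*-sum (- sign (toℕ j)) (a j) (λ i → sign (toℕ i) * (b i * M i j)))) ⟩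
  sum (λ j → sum (λ i → - sign (toℕ j) * (a j * (sign (toℕ i) * (b i * M i j)))))
    ≡⟨ ∑-comm (λ j i → - sign (toℕ j) * (a j * (sign (toℕ i) * (b i * M i j)))) ⟩
  sum (λ i → sum (λ j → - sign (toℕ j) * (a j * (sign (toℕ i) * (b i * M i j)))))
    ≡⟨ sum-cong-≗ (λ i → trans (sum-cong-≗ (λ j → reorder (sign (toℕ j)) (a j) (sign (toℕ i)) (b i) (M i j)))
                               (sym (*-*-sum (- sign (toℕ i)) (b i) (λ j → sign (toℕ j) * (a j * M i j))))) ⟩
  sum (λ i → - sign (toℕ i) * (b i * sum (laplaceTerm (minor (fsuc i) fzero X))))
    ≡⟨ sum-cong-≗ (λ i → cong (λ d → - sign (toℕ i) * (b i * d))
                              (det-expandFirstRow n (minor (fsuc i) fzero X))) ⟨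
  sum (λ i → - sign (toℕ i) * (b i * det (suc n) (minor (fsuc i) fzero X))) ∎)
  where
  a b : Fin (suc n) → ℤ
  a j = X fzero (fsuc j)
  b i = X (fsuc i) fzero
  M : Fin (suc n) → Fin (suc n) → ℤ
  M i j = det n (λ r c → X (fsuc (punchIn i r)) (fsuc (punchIn j c)))
  reorder : ∀ sⱼ aⱼ sᵢ bᵢ d →
            - sⱼ * (aⱼ * (sᵢ * (bᵢ * d))) ≡ - sᵢ * (bᵢ * (sⱼ * (aⱼ * d)))
  reorder = solve-∀

det-transpose : ∀ n (X : Matrix n) → det n (X ᵀ) ≡ det n X
det-transpose zero    X = refl
det-transpose (suc n) X = begin
  det (suc n) (X ᵀ)     ≡⟨ det-expandFirstRow n (X ᵀ) ⟩
  sum (laplaceTerm (X ᵀ)) ≡⟨ sum-cong-≗ (λ j → cong (λ d → sign (toℕ j) * (X j fzero * d))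
                                                  (det-transpose n (minor j fzero X))) ⟩
  sum (λ i → sign (toℕ i) * (X i fzero * det n (minor i fzero X))) ≡⟨ det-expandFirstColumn n X ⟨
  det (suc n) X         ∎

vanishing-term : ∀ s x {d} → d ≡ 0ℤ → s * (x * d) ≡ 0ℤ
vanishing-term s x refl = trans (cong (s *_) (ℤₚ.*-zeroʳ x)) (ℤₚ.*-zeroʳ s)

det-adjacentEqualRows : ∀ n (X : Matrix (suc n)) (r : Fin n) → X (inject₁ r) ≗ X (fsuc r) →
                        det (suc n) X ≡ 0ℤ
-- Along the first column the terms of two equal leading rows cancel, and all other minors again have two
-- equal adjacent rows.
det-adjacentEqualRows (suc n) X fzero X₀≗X₁ = begin
  det (suc (suc n)) X
    ≡⟨ det-expandFirstColumn (suc n) X ⟩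
  t₀ + (- 1ℤ * (X (fsuc fzero) fzero * det (suc n) (minor (fsuc fzero) fzero X)) + rest)
    ≡⟨ cong₂ (λ x d → t₀ + (- 1ℤ * (x * d) + rest))
             (sym (X₀≗X₁ fzero)) (det-cong (suc n) sameMinor) ⟩
  t₀ + (- 1ℤ * (X fzero fzero * det (suc n) (minor fzero fzero X)) + rest)
    ≡⟨ cong (λ z → t₀ + (- 1ℤ * (X fzero fzero * det (suc n) (minor fzero fzero X)) + z))
            rest≡0 ⟩
  t₀ + (- 1ℤ * (X fzero fzero * det (suc n) (minor fzero fzero X)) + 0ℤ)
    ≡⟨ cancel (X fzero fzero) (det (suc n) (minor fzero fzero X)) ⟩
  0ℤ ∎
  where
  t₀ : ℤ
  t₀ = 1ℤ * (X fzero fzero * det (suc n) (minor fzero fzero X))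
  rest : ℤ
  rest = sum (λ i → sign (toℕ (fsuc (fsuc i))) *
                    (X (fsuc (fsuc i)) fzero * det (suc n) (minor (fsuc (fsuc i)) fzero X)))
  sameMinor : ∀ r c → minor (fsuc fzero) fzero X r c ≡ minor fzero fzero X r c
  sameMinor fzero    c = X₀≗X₁ (fsuc c)
  sameMinor (fsuc r) c = refl
  -- matching on i only serves to expose that n is a successor
  vanish : ∀ i → det (suc n) (minor (fsuc (fsuc i)) fzero X) ≡ 0ℤ
  vanish i@fzero    = det-adjacentEqualRows n (minor (fsuc (fsuc i)) fzero X) fzero (X₀≗X₁ ∘ fsuc)
  vanish i@(fsuc _) = det-adjacentEqualRows n (minor (fsuc (fsuc i)) fzero X) fzero (X₀≗X₁ ∘ fsuc)
  rest≡0 : rest ≡ 0ℤ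
  rest≡0 = sum-zero n (λ i → vanishing-term (sign (toℕ (fsuc (fsuc i)))) (X (fsuc (fsuc i)) fzero) (vanish i))
  cancel : ∀ x d → 1ℤ * (x * d) + (- 1ℤ * (x * d) + 0ℤ) ≡ 0ℤ
  cancel = solve-∀
det-adjacentEqualRows (suc n) X (fsuc r) Xᵣ≗Xᵣ₊₁ = begin
  det (suc (suc n)) X   ≡⟨ det-expandFirstRow (suc n) X ⟩
  sum (laplaceTerm X)   ≡⟨ sum-zero (suc (suc n)) (λ j → vanishing-term (sign (toℕ j)) (X fzero j)
                             (det-adjacentEqualRows n (minor fzero j X) r (Xᵣ≗Xᵣ₊₁ ∘ punchIn j))) ⟩
  0ℤ                    ∎

det-swapRows : ∀ n (X : Matrix n) {a b : Fin n} → a ≢ b →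
  (∀ Y → Y a ≗ Y b → det n Y ≡ 0ℤ) → det n (setRow a (X b) (setRow b (X a) X)) ≡ - det n X
det-swapRows n X {a} {b} a≢b alternating = begin
  det n (S w u)                                      ≡⟨ solve-neg (det n (S w u)) (det n (S u w)) ⟩
  - det n (S u w) + (det n (S u w) + det n (S w u)) ≡⟨ cong (- det n (S u w) +_) cross≡0 ⟩
  - det n (S u w) + 0ℤ                               ≡⟨ ℤₚ.+-identityʳ _ ⟩
  - det n (S u w)                                    ≡⟨ cong -_ (det-cong n X≈Suw) ⟨
  - det n X                                          ∎
  where
  u w : Fin n → ℤ
  u = X a
  w = X b
  S : (Fin n → ℤ) → (Fin n → ℤ) → Matrix n
  S v v′ = setRow a v (setRow b v′ X)
  Sᵃ : ∀ v v′ → S v v′ a ≗ v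
  Sᵃ v v′ = setRow-same a v _
  Sᵇ : ∀ v v′ → S v v′ b ≗ v′
  Sᵇ v v′ c = trans (setRow-other v _ (a≢b ∘ sym) c) (setRow-same b v′ X c)
  X≈Suw : ∀ r c → X r c ≡ S u w r c
  X≈Suw r c with r Finₚ.≟ a | r Finₚ.≟ b
  ... | yes refl | _      = sym (Sᵃ u w c)
  ... | no _     | yes refl = sym (Sᵇ u w c)
  ... | no r≢a   | no r≢b = sym (trans (setRow-other u _ r≢a c) (setRow-other w X r≢b c))
  _⊕_ : (Fin n → ℤ) → (Fin n → ℤ) → Fin n → ℤ
  (v ⊕ v′) c = v c + 1ℤ * v′ c
  linearᵃ : ∀ v₁ v₂ v′ →
            det n (S (v₁ ⊕ v₂) v′) ≡ det n (S v₁ v′) + 1ℤ * det n (S v₂ v′)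
  linearᵃ v₁ v₂ v′ = det-linearInRow n _ _ _ a 1ℤ
    (λ r r≢a c → trans (setRow-other _ _ r≢a c) (sym (setRow-other _ _ r≢a c)))
    (λ r r≢a c → trans (setRow-other _ _ r≢a c) (sym (setRow-other _ _ r≢a c)))
    (λ c → trans (Sᵃ _ v′ c) (sym (cong₂ (λ x y → x + 1ℤ * y) (Sᵃ v₁ v′ c) (Sᵃ v₂ v′ c))))
  offᵇ : ∀ v v′ v″ r → r ≢ b → S v v′ r ≗ S v v″ r
  offᵇ v v′ v″ r r≢b c with r Finₚ.≟ a
  ... | yes refl = trans (Sᵃ v v′ c) (sym (Sᵃ v v″ c))
  ... | no r≢a   = trans (setRow-other v _ r≢a c)
                     (trans (setRow-other v′ X r≢b c)
                       (sym (trans (setRow-other v _ r≢a c) (setRow-other v″ X r≢b c))))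
  linearᵇ : ∀ v v′₁ v′₂ →
            det n (S v (v′₁ ⊕ v′₂)) ≡ det n (S v v′₁) + 1ℤ * det n (S v v′₂)
  linearᵇ v v′₁ v′₂ = det-linearInRow n _ _ _ b 1ℤ (offᵇ v _ v′₁) (offᵇ v v′₂ v′₁)
    (λ c → trans (Sᵇ v _ c) (sym (cong₂ (λ x y → x + 1ℤ * y) (Sᵇ v v′₁ c) (Sᵇ v v′₂ c))))
  equal : ∀ v → det n (S v v) ≡ 0ℤ
  equal v = alternating (S v v) (λ c → trans (Sᵃ v v c) (sym (Sᵇ v v c)))
  cross≡0 : det n (S u w) + det n (S w u) ≡ 0ℤ
  cross≡0 = begin
    det n (S u w) + det n (S w u)
      ≡⟨ expand (det n (S u u)) (det n (S u w)) (det n (S w u)) (det n (S w w)) (equal u) (equal w) ⟩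
    (det n (S u u) + 1ℤ * det n (S u w)) + 1ℤ * (det n (S w u) + 1ℤ * det n (S w w))
      ≡⟨ cong₂ (λ x y → x + 1ℤ * y) (linearᵇ u u w) (linearᵇ w u w) ⟨
    det n (S u (u ⊕ w)) + 1ℤ * det n (S w (u ⊕ w))
      ≡⟨ linearᵃ u w (u ⊕ w) ⟨
    det n (S (u ⊕ w) (u ⊕ w))
      ≡⟨ equal (u ⊕ w) ⟩
    0ℤ ∎
    where
    expand : ∀ p x y q → p ≡ 0ℤ → q ≡ 0ℤ → x + y ≡ (p + 1ℤ * x) + 1ℤ * (y + 1ℤ * q)
    expand p x y q refl refl = solve-expand x y
      where
      solve-expand : ∀ x y → x + y ≡ (0ℤ + 1ℤ * x) + 1ℤ * (y + 1ℤ * 0ℤ)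
      solve-expand = solve-∀
  solve-neg : ∀ x y → x ≡ - y + (y + x)
  solve-neg = solve-∀

det-equalRowsAtDistance : ∀ d n (X : Matrix n) (a b : Fin n) → toℕ b ≡ suc (d ℕ.+ toℕ a) →
                          X a ≗ X b → det n X ≡ 0ℤ
det-equalRowsAtDistance zero (suc n) X a (fsuc b) b=1+a Xa≗Xb
  with refl ← Finₚ.toℕ-injective {i = a} {inject₁ b}
                (sym (trans (Finₚ.toℕ-inject₁ b) (ℕₚ.suc-injective b=1+a)))
  = det-adjacentEqualRows n X b Xa≗Xb
det-equalRowsAtDistance (suc d) (suc n) X a (fsuc b) b=2+d+a Xa≗Xb = begin
  det (suc n) X      ≡⟨ ℤₚ.neg-involutive _ ⟨
  - - det (suc n) X  ≡⟨ cong -_ (det-swapRows (suc n) X b′≢b (λ Y → det-adjacentEqualRows n Y b)) ⟨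
  - det (suc n) X′   ≡⟨ cong -_ (det-equalRowsAtDistance d (suc n) X′ a b′ b′=1+d+a X′a≗X′b′) ⟩
  - 0ℤ               ≡⟨⟩
  0ℤ                 ∎
  where
  b′ : Fin (suc n)
  b′ = inject₁ b
  b′=1+d+a : toℕ b′ ≡ suc (d ℕ.+ toℕ a)
  b′=1+d+a = trans (Finₚ.toℕ-inject₁ b) (ℕₚ.suc-injective b=2+d+a)
  b′≢b : b′ ≢ fsuc b
  b′≢b b′=b = ℕₚ.1+n≢n (sym (trans (sym (Finₚ.toℕ-inject₁ b)) (cong toℕ b′=b)))
  a≢b′ : a ≢ b′
  a≢b′ a=b′ = ℕₚ.m≢1+n+m (toℕ a) (trans (cong toℕ a=b′) b′=1+d+a)
  a≢b : a ≢ fsuc b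
  a≢b a=b = ℕₚ.m≢1+n+m (toℕ a) {suc d} (trans (cong toℕ a=b) b=2+d+a)
  X′ : Matrix (suc n)
  X′ = setRow b′ (X (fsuc b)) (setRow (fsuc b) (X b′) X)
  X′a≗X′b′ : X′ a ≗ X′ b′
  X′a≗X′b′ c = begin
    X′ a c                         ≡⟨ setRow-other _ _ a≢b′ c ⟩
    setRow (fsuc b) (X b′) X a c   ≡⟨ setRow-other _ X a≢b c ⟩
    X a c                          ≡⟨ Xa≗Xb c ⟩
    X (fsuc b) c                   ≡⟨ setRow-same b′ _ _ c ⟨
    X′ b′ c                        ∎

det-equalRows< : ∀ n (X : Matrix n) {a b : Fin n} → toℕ a < toℕ b → X a ≗ X b → det n X ≡ 0ℤ
det-equalRows< n X {a} {b} a<b = det-equalRowsAtDistance (toℕ b ∸ suc (toℕ a)) n X a b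
  (trans (sym (ℕₚ.m∸n+n≡m a<b)) (ℕₚ.+-suc (toℕ b ∸ suc (toℕ a)) (toℕ a)))

det-equalRows : ∀ n (X : Matrix n) {a b : Fin n} → a ≢ b → X a ≗ X b → det n X ≡ 0ℤ
det-equalRows n X {a} {b} a≢b Xa≗Xb with ℕₚ.<-cmp (toℕ a) (toℕ b)
... | tri< a<b _ _ = det-equalRows< n X a<b Xa≗Xb
... | tri≈ _ a=b _ = contradiction (Finₚ.toℕ-injective a=b) a≢b
... | tri> _ _ b<a = det-equalRows< n X b<a (sym ∘ Xa≗Xb)

det-linearInRow-sum : ∀ n m (X Y : Matrix n) (a : Fin n) (w : Fin m → ℤ) (Z : Fin m → Matrix n) →
  (∀ r → r ≢ a → X r ≗ Y r) → (∀ s r → r ≢ a → Z s r ≗ Y r) →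
  (∀ c → X a c ≡ Y a c + sum (λ s → w s * Z s a c)) →
  det n X ≡ det n Y + sum (λ s → w s * det n (Z s))
det-linearInRow-sum n zero X Y a w Z X≈Y Z≈Y Xa =
  trans (det-cong n X≈Y′) (sym (ℤₚ.+-identityʳ _))
  where
  X≈Y′ : ∀ r c → X r c ≡ Y r c
  X≈Y′ r c with r Finₚ.≟ a
  ... | yes refl = trans (Xa c) (ℤₚ.+-identityʳ _)
  ... | no r≢a   = X≈Y r r≢a c
det-linearInRow-sum n (suc m) X Y a w Z X≈Y Z≈Y Xa = begin
  det n X
    ≡⟨ det-linearInRow-sum n m X Y′ a (w ∘ fsuc) (Z ∘ fsuc) X≈Y′ Z≈Y′ Xa′ ⟩
  det n Y′ + rest
    ≡⟨ cong (_+ rest)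
            (det-linearInRow n Y′ Y (Z fzero) a (w fzero) Y′≈Y (Z≈Y fzero) (setRow-same a _ Y)) ⟩
  (det n Y + w fzero * det n (Z fzero)) + rest
    ≡⟨ ℤₚ.+-assoc (det n Y) _ rest ⟩
  det n Y + sum (λ s → w s * det n (Z s)) ∎
  where
  rest : ℤ
  rest = sum (λ s → w (fsuc s) * det n (Z (fsuc s)))
  Y′ : Matrix n
  Y′ = setRow a (λ c → Y a c + w fzero * Z fzero a c) Y
  Y′≈Y : ∀ r → r ≢ a → Y′ r ≗ Y r
  Y′≈Y r r≢a = setRow-other _ Y r≢a
  X≈Y′ : ∀ r → r ≢ a → X r ≗ Y′ r
  X≈Y′ r r≢a c = trans (X≈Y r r≢a c) (sym (Y′≈Y r r≢a c))
  Z≈Y′ : ∀ s r → r ≢ a → Z (fsuc s) r ≗ Y′ r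
  Z≈Y′ s r r≢a c = trans (Z≈Y (fsuc s) r r≢a c) (sym (Y′≈Y r r≢a c))
  Xa′ : ∀ c → X a c ≡ Y′ a c + sum (λ s → w (fsuc s) * Z (fsuc s) a c)
  Xa′ c = begin
    X a c
      ≡⟨ Xa c ⟩
    Y a c + (w fzero * Z fzero a c + sum (λ s → w (fsuc s) * Z (fsuc s) a c))
      ≡⟨ ℤₚ.+-assoc (Y a c) _ _ ⟨
    (Y a c + w fzero * Z fzero a c) + sum (λ s → w (fsuc s) * Z (fsuc s) a c)
      ≡⟨ cong (_+ _) (setRow-same a _ Y c) ⟨
    Y′ a c + sum (λ s → w (fsuc s) * Z (fsuc s) a c) ∎

det-addRowCombination : ∀ n (X X′ : Matrix n) (a : Fin n) (w : Fin n → ℤ) → w a ≡ 0ℤ →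
  (∀ r → r ≢ a → X′ r ≗ X r) → (∀ c → X′ a c ≡ X a c + sum (λ s → w s * X s c)) →
  det n X′ ≡ det n X
det-addRowCombination n X X′ a w wa≡0 X′≈X X′a = begin
  det n X′                                 ≡⟨ det-linearInRow-sum n n X′ X a w Z X′≈X Z≈X X′a′ ⟩
  det n X + sum (λ s → w s * det n (Z s))  ≡⟨ cong (det n X +_) (sum-zero n vanish) ⟩
  det n X + 0ℤ                             ≡⟨ ℤₚ.+-identityʳ _ ⟩
  det n X                                  ∎
  where
  Z : Fin n → Matrix n
  Z s = setRow a (X s) X
  Z≈X : ∀ s r → r ≢ a → Z s r ≗ X r
  Z≈X s r r≢a = setRow-other _ X r≢a
  X′a′ : ∀ c → X′ a c ≡ X a c + sum (λ s → w s * Z s a c)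
  X′a′ c = trans (X′a c) (cong (X a c +_) (sum-cong-≗ (λ s → cong (w s *_) (sym (setRow-same a _ X c)))))
  vanish : ∀ s → w s * det n (Z s) ≡ 0ℤ
  vanish s with s Finₚ.≟ a
  ... | yes refl = cong (_* det n (Z s)) wa≡0
  ... | no s≢a   = trans (cong (w s *_) (det-equalRows n (Z s) (s≢a ∘ sym)
                     (λ c → trans (setRow-same a _ X c) (sym (setRow-other _ X s≢a c)))))
                     (ℤₚ.*-zeroʳ (w s))

spliceRows : ∀ {n} → ℕ → Matrix n → Matrix n → Matrix n
spliceRows k A T r with toℕ r <? k
... | yes _ = A r
... | no  _ = T r

spliceRows-< : ∀ {n k} (A T : Matrix n) r → toℕ r < k → spliceRows k A T r ≗ A r
spliceRows-< {k = k} A T r r<k with toℕ r <? k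
... | yes _  = λ _ → refl
... | no r≮k = contradiction r<k r≮k

spliceRows-≥ : ∀ {n k} (A T : Matrix n) r → ¬ toℕ r < k → spliceRows k A T r ≗ T r
spliceRows-≥ {k = k} A T r r≮k with toℕ r <? k
... | yes r<k = contradiction r<k r≮k
... | no _    = λ _ → refl

module _ {n} (A T : Matrix n) (coef : Fin n → Fin n → ℤ)
         (coef≡0 : ∀ r s → toℕ r ≤ toℕ s → coef r s ≡ 0ℤ)
         (T-def : ∀ r c → T r c ≡ A r c + sum (λ s → coef r s * A s c)) where

  det-spliceRows-suc : ∀ k → k < n → det n (spliceRows k A T) ≡ det n (spliceRows (suc k) A T)
  det-spliceRows-suc k k<n = det-addRowCombination n (spliceRows (suc k) A T) (spliceRows k A T) a (coef a)
    (coef≡0 a a ℕₚ.≤-refl) sameOff rowA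
    where
    a : Fin n
    a = fromℕ< k<n
    a=k : toℕ a ≡ k
    a=k = Finₚ.toℕ-fromℕ< k<n
    sameOff : ∀ r → r ≢ a → spliceRows k A T r ≗ spliceRows (suc k) A T r
    sameOff r r≢a c with ℕₚ.<-cmp (toℕ r) k
    ... | tri< r<k _ _   = trans (spliceRows-< A T r r<k c) (sym (spliceRows-< A T r (ℕₚ.m<n⇒m<1+n r<k) c))
    ... | tri≈ _ r=k _   = contradiction (Finₚ.toℕ-injective (trans r=k (sym a=k))) r≢a
    ... | tri> r≮k _ k<r = trans (spliceRows-≥ A T r r≮k c)
                                 (sym (spliceRows-≥ A T r (ℕₚ.<⇒≱ k<r ∘ ℕₚ.≤-pred) c))
    earlierRow : ∀ s c → coef a s * A s c ≡ coef a s * spliceRows (suc k) A T s c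
    earlierRow s c with toℕ s ℕₚ.≤? k
    ... | yes s≤k = cong (coef a s *_) (sym (spliceRows-< A T s (s≤s s≤k) c))
    ... | no s≰k  = trans (cong (_* A s c) coef≡0′) (sym (cong (_* spliceRows (suc k) A T s c) coef≡0′))
      where
      coef≡0′ : coef a s ≡ 0ℤ
      coef≡0′ = coef≡0 a s (subst (_≤ toℕ s) (sym a=k) (ℕₚ.<⇒≤ (ℕₚ.≰⇒> s≰k)))
    rowA : ∀ c → spliceRows k A T a c
                   ≡ spliceRows (suc k) A T a c + sum (λ s → coef a s * spliceRows (suc k) A T s c)
    rowA c = begin
      spliceRows k A T a c                  ≡⟨ spliceRows-≥ A T a (ℕₚ.<-irrefl a=k) c ⟩
      T a c                                 ≡⟨ T-def a c ⟩
      A a c + sum (λ s → coef a s * A s c)  ≡⟨ cong₂ _+_ (sym (spliceRows-< A T a a<1+k c))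
                                                         (sum-cong-≗ (λ s → earlierRow s c)) ⟩
      spliceRows (suc k) A T a c + sum (λ s → coef a s * spliceRows (suc k) A T s c) ∎
      where
      a<1+k : toℕ a < suc k
      a<1+k = subst (_< suc k) (sym a=k) (ℕₚ.n<1+n k)

  det-addEarlierRows : det n T ≡ det n A
  det-addEarlierRows = begin
    det n T                  ≡⟨ det-cong n (λ r → sym ∘ spliceRows-≥ {k = 0} A T r λ ()) ⟩
    det n (spliceRows 0 A T) ≡⟨ fromSplice n 0 (ℕₚ.+-identityʳ n) ⟩
    det n A                  ∎
    where
    fromSplice : ∀ d k → d ℕ.+ k ≡ n → det n (spliceRows k A T) ≡ det n A
    fromSplice zero    k k=n   =
      det-cong n (λ r → spliceRows-< A T r (subst (toℕ r <_) (sym k=n) (Finₚ.toℕ<n r)))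
    fromSplice (suc d) k d+k=n =
      trans (det-spliceRows-suc k (subst (k <_) d+k=n (ℕₚ.m<n+m k (s≤s z≤n))))
            (fromSplice d (suc k) (trans (ℕₚ.+-suc d k) d+k=n))

det-firstRowUnit : ∀ n (X : Matrix (suc n)) → X fzero fzero ≡ 1ℤ → (∀ c → X fzero (fsuc c) ≡ 0ℤ) →
                   det (suc n) X ≡ det n (minor fzero fzero X)
det-firstRowUnit n X X₀₀≡1 X₀ⱼ≡0 = begin
  1ℤ * (X fzero fzero * d) + sumFin n (laplaceTerm X ∘ fsuc)
    ≡⟨ cong₂ (λ x s → 1ℤ * (x * d) + s) X₀₀≡1
             (trans (sumFin≡sum n (laplaceTerm X ∘ fsuc)) (sum-zero n offDiagonal)) ⟩
  1ℤ * (1ℤ * d) + 0ℤ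
    ≡⟨ unit d ⟩
  d ∎
  where
  d : ℤ
  d = det n (minor fzero fzero X)
  offDiagonal : ∀ j → laplaceTerm X (fsuc j) ≡ 0ℤ
  offDiagonal j = trans (cong (λ x → - sign (toℕ j) * (x * det n (minor fzero (fsuc j) X))) (X₀ⱼ≡0 j))
                        (ℤₚ.*-zeroʳ (- sign (toℕ j)))
  unit : ∀ d → 1ℤ * (1ℤ * d) + 0ℤ ≡ d
  unit = solve-∀

sumBelow : ℕ → (ℕ → ℤ) → ℤ
sumBelow n h = sum {n} (λ i → h (toℕ i))

convolve : ℕ → (ℕ → ℤ) → (ℕ → ℤ) → ℤ
convolve M F G = sumBelow (suc M) (λ k → F k * G (M ∸ k))

sumBelow-cong : ∀ n {g h : ℕ → ℤ} → (∀ i → i < n → g i ≡ h i) → sumBelow n g ≡ sumBelow n h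
sumBelow-cong zero    g≈h = refl
sumBelow-cong (suc n) g≈h =
  cong₂ _+_ (g≈h 0 (s≤s z≤n)) (sumBelow-cong n (λ i i<n → g≈h (suc i) (s≤s i<n)))

sumBelow-+ : ∀ m n (h : ℕ → ℤ) →
             sumBelow (m ℕ.+ n) h ≡ sumBelow m h + sumBelow n (λ t → h (m ℕ.+ t))
sumBelow-+ zero    n h = sym (ℤₚ.+-identityˡ _)
sumBelow-+ (suc m) n h = trans (cong (h 0 +_) (sumBelow-+ m n (h ∘ suc))) (sym (ℤₚ.+-assoc (h 0) _ _))

sumBelow-suc : ∀ n (h : ℕ → ℤ) → sumBelow (suc n) h ≡ sumBelow n h + h n
sumBelow-suc zero    h = trans (ℤₚ.+-identityʳ (h 0)) (sym (ℤₚ.+-identityˡ (h 0)))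
sumBelow-suc (suc n) h = trans (cong (h 0 +_) (sumBelow-suc n (h ∘ suc))) (sym (ℤₚ.+-assoc (h 0) _ _))

sumBelow-reverse : ∀ n (h : ℕ → ℤ) → sumBelow n h ≡ sumBelow n (λ i → h (n ∸ suc i))
sumBelow-reverse zero    h = refl
sumBelow-reverse (suc n) h = begin
  h 0 + sumBelow n (h ∘ suc)                   ≡⟨ cong (h 0 +_) (sumBelow-reverse n (h ∘ suc)) ⟩
  h 0 + sumBelow n (λ i → h (suc (n ∸ suc i))) ≡⟨ ℤₚ.+-comm (h 0) _ ⟩
  sumBelow n (λ i → h (suc (n ∸ suc i))) + h 0
    ≡⟨ cong₂ _+_ (sumBelow-cong n (λ i i<n → cong h (sym (ℕₚ.+-∸-assoc 1 i<n))))
                 (cong h (sym (ℕₚ.n∸n≡0 n))) ⟩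
  sumBelow n (λ i → h (suc n ∸ suc i)) + h (suc n ∸ suc n)
    ≡⟨ sumBelow-suc n (λ i → h (suc n ∸ suc i)) ⟨
  sumBelow (suc n) (λ i → h (suc n ∸ suc i))   ∎

sumBelow-neg : ∀ n (u w : ℕ → ℤ) → sumBelow n (λ s → - u s * w s) ≡ - sumBelow n (λ s → u s * w s)
sumBelow-neg zero    u w = refl
sumBelow-neg (suc n) u w =
  trans (cong₂ _+_ (sym (ℤₚ.neg-distribˡ-* (u 0) (w 0))) (sumBelow-neg n (u ∘ suc) (w ∘ suc)))
        (sym (ℤₚ.neg-distrib-+ (u 0 * w 0) _))

truncateAt : ℕ → (ℕ → ℤ) → ℕ → ℤ
truncateAt r u s = if s ℕ.<ᵇ r then u s else 0ℤ

truncateAt-≥ : ∀ {r s} (u : ℕ → ℤ) → r ≤ s → truncateAt r u s ≡ 0ℤ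
truncateAt-≥ {r} {s} u r≤s with s ℕ.<ᵇ r in s<ᵇr
... | true  = contradiction r≤s (ℕₚ.<⇒≱ (ℕₚ.<ᵇ⇒< s r (subst T (sym s<ᵇr) tt)))
... | false = refl

sumBelow-truncateAt : ∀ r n → r ≤ n → ∀ (u w : ℕ → ℤ) →
                      sumBelow n (λ s → truncateAt r u s * w s) ≡ sumBelow r (λ s → u s * w s)
sumBelow-truncateAt zero    n       _         u w = sum-zero n (λ _ → refl)
sumBelow-truncateAt (suc r) (suc n) (s≤s r≤n) u w =
  cong (u 0 * w 0 +_) (sumBelow-truncateAt r n r≤n (u ∘ suc) (w ∘ suc))

module _ (f a : ℕ → ℤ) where

  reducedHankelRow : (∀ N → f (suc N) ≡ convolve N a f) → ∀ {n} ρ γ → ρ < n →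
    f (suc ρ ℕ.+ γ) + sumBelow (suc n) (λ s → truncateAt (suc ρ) (λ s → - a (ρ ∸ s)) s * f (s ℕ.+ γ))
      ≡ sumBelow γ (λ t → a (suc (ρ ℕ.+ t)) * f (γ ∸ suc t))
  reducedHankelRow f-rec {n} ρ γ ρ<n = begin
    f (suc ρ ℕ.+ γ) + sumBelow (suc n) (λ s → truncateAt (suc ρ) (λ s → - a (ρ ∸ s)) s * f (s ℕ.+ γ))
      ≡⟨ cong₂ _+_ (f-rec (ρ ℕ.+ γ))
           (trans (sumBelow-truncateAt (suc ρ) (suc n) (s≤s (ℕₚ.<⇒≤ ρ<n)) (λ s → - a (ρ ∸ s)) fᵧ)
                  (sumBelow-neg (suc ρ) (λ s → a (ρ ∸ s)) fᵧ)) ⟩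
    sumBelow (suc ρ ℕ.+ γ) h + - earlier
      ≡⟨ cong (_+ - earlier) (sumBelow-+ (suc ρ) γ h) ⟩
    (sumBelow (suc ρ) h + later) + - earlier
      ≡⟨ cong (λ x → (x + later) + - earlier)
              (trans (sumBelow-reverse (suc ρ) h) (sumBelow-cong (suc ρ) reindex)) ⟩
    (earlier + later) + - earlier
      ≡⟨ cancel earlier later ⟩
    later
      ≡⟨ sumBelow-cong γ (λ t _ → cong (λ k → a (suc (ρ ℕ.+ t)) * f k) (shift t)) ⟩
    sumBelow γ (λ t → a (suc (ρ ℕ.+ t)) * f (γ ∸ suc t)) ∎
    where
    fᵧ h : ℕ → ℤ
    fᵧ s = f (s ℕ.+ γ)
    h k = a k * f (ρ ℕ.+ γ ∸ k)
    earlier : ℤ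
    earlier = sumBelow (suc ρ) (λ s → a (ρ ∸ s) * f (s ℕ.+ γ))
    later : ℤ
    later = sumBelow γ (λ t → h (suc ρ ℕ.+ t))
    reindex : ∀ i → i < suc ρ → h (suc ρ ∸ suc i) ≡ a (ρ ∸ i) * f (i ℕ.+ γ)
    reindex i i<1+ρ = cong (λ k → a (ρ ∸ i) * f k) (begin
      ρ ℕ.+ γ ∸ (ρ ∸ i)    ≡⟨ ℕₚ.+-∸-comm γ (ℕₚ.m∸n≤m ρ i) ⟩
      (ρ ∸ (ρ ∸ i)) ℕ.+ γ  ≡⟨ cong (ℕ._+ γ) (ℕₚ.m∸[m∸n]≡n (ℕₚ.≤-pred i<1+ρ)) ⟩
      i ℕ.+ γ              ∎)
    shift : ∀ t → ρ ℕ.+ γ ∸ suc (ρ ℕ.+ t) ≡ γ ∸ suc t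
    shift t = trans (cong (ρ ℕ.+ γ ∸_) (sym (ℕₚ.+-suc ρ t))) (ℕₚ.[m+n]∸[m+o]≡n∸o ρ γ (suc t))
    cancel : ∀ x y → (x + y) + - x ≡ y
    cancel = solve-∀

  convolve-asRowCombination : f 0 ≡ 1ℤ → ∀ {n} ρ γ → ρ < n →
    convolve ρ (λ t → a (suc (γ ℕ.+ t))) f
      ≡ a (suc (ρ ℕ.+ γ)) + sumBelow n (λ s → truncateAt ρ (λ s → f (ρ ∸ s)) s * a (suc (s ℕ.+ γ)))
  convolve-asRowCombination f₀≡1 {n} ρ γ ρ<n = begin
    convolve ρ (λ t → a (suc (γ ℕ.+ t))) f
      ≡⟨ sumBelow-suc ρ (λ t → a (suc (γ ℕ.+ t)) * f (ρ ∸ t)) ⟩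
    sumBelow ρ (λ t → a (suc (γ ℕ.+ t)) * f (ρ ∸ t)) + a (suc (γ ℕ.+ ρ)) * f (ρ ∸ ρ)
      ≡⟨ cong₂ _+_ (sumBelow-cong ρ (λ t _ → swap t)) diagonal ⟩
    combination + a (suc (ρ ℕ.+ γ))
      ≡⟨ ℤₚ.+-comm combination (a (suc (ρ ℕ.+ γ))) ⟩
    a (suc (ρ ℕ.+ γ)) + combination
      ≡⟨ cong (a (suc (ρ ℕ.+ γ)) +_)
              (sumBelow-truncateAt ρ n (ℕₚ.<⇒≤ ρ<n) (λ s → f (ρ ∸ s)) (λ s → a (suc (s ℕ.+ γ))))
      ⟨
    a (suc (ρ ℕ.+ γ)) + sumBelow n (λ s → truncateAt ρ (λ s → f (ρ ∸ s)) s * a (suc (s ℕ.+ γ))) ∎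
    where
    combination : ℤ
    combination = sumBelow ρ (λ s → f (ρ ∸ s) * a (suc (s ℕ.+ γ)))
    swap : ∀ t → a (suc (γ ℕ.+ t)) * f (ρ ∸ t) ≡ f (ρ ∸ t) * a (suc (t ℕ.+ γ))
    swap t = trans (ℤₚ.*-comm (a (suc (γ ℕ.+ t))) (f (ρ ∸ t)))
                   (cong (λ k → f (ρ ∸ t) * a (suc k)) (ℕₚ.+-comm γ t))
    diagonal : a (suc (γ ℕ.+ ρ)) * f (ρ ∸ ρ) ≡ a (suc (ρ ℕ.+ γ))
    diagonal = begin
      a (suc (γ ℕ.+ ρ)) * f (ρ ∸ ρ)
        ≡⟨ cong₂ (λ k l → a (suc k) * f l) (ℕₚ.+-comm γ ρ) (ℕₚ.n∸n≡0 ρ) ⟩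
      a (suc (ρ ℕ.+ γ)) * f 0       ≡⟨ cong (a (suc (ρ ℕ.+ γ)) *_) f₀≡1 ⟩
      a (suc (ρ ℕ.+ γ)) * 1ℤ        ≡⟨ ℤₚ.*-identityʳ _ ⟩
      a (suc (ρ ℕ.+ γ))             ∎

  hankel-1/[1-x*a] : f 0 ≡ 1ℤ → (∀ N → f (suc N) ≡ convolve N a f) →
                     ∀ n → hankel 0 (suc n) f ≡ hankel 1 n a
  hankel-1/[1-x*a] f₀≡1 f-rec n = begin
    det (suc n) H₀                  ≡⟨ det-addEarlierRows H₀ R coef₁ coef₁-upper (λ _ _ → refl) ⟨
    det (suc n) R                   ≡⟨ det-transpose (suc n) R ⟨
    det (suc n) (R ᵀ)               ≡⟨ det-firstRowUnit n (R ᵀ) R₀₀≡1 (λ c → reducedRow c fzero) ⟩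
    det n (minor fzero fzero (R ᵀ)) ≡⟨ det-cong n (λ r c → reducedRow c (fsuc r)) ⟩
    det n Q                         ≡⟨ det-addEarlierRows H₁ Q coef₂ coef₂-upper
                                        (λ r c → convolve-asRowCombination f₀≡1 (toℕ r) (toℕ c) (Finₚ.toℕ<n r)) ⟩
    det n H₁                        ∎
    where
    H₀ : Matrix (suc n)
    H₀ i j = f (toℕ i ℕ.+ toℕ j)
    coef₁ : Fin (suc n) → Fin (suc n) → ℤ
    coef₁ r s = truncateAt (toℕ r) (λ s → - a (toℕ r ∸ suc s)) (toℕ s)
    coef₁-upper : ∀ r s → toℕ r ≤ toℕ s → coef₁ r s ≡ 0ℤ
    coef₁-upper r s = truncateAt-≥ (λ s → - a (toℕ r ∸ suc s))
    R : Matrix (suc n)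
    R r c = H₀ r c + sum (λ s → coef₁ r s * H₀ s c)
    reducedRow : ∀ c (c′ : Fin (suc n)) →
                 R (fsuc c) c′ ≡ sumBelow (toℕ c′) (λ t → a (suc (toℕ c ℕ.+ t)) * f (toℕ c′ ∸ suc t))
    reducedRow c c′ = reducedHankelRow f-rec (toℕ c) (toℕ c′) (Finₚ.toℕ<n c)
    R₀₀≡1 : R fzero fzero ≡ 1ℤ
    R₀₀≡1 = cong₂ _+_ f₀≡1 (sum-zero (suc n) (λ _ → refl))
    H₁ : Matrix n
    H₁ i j = a (suc (toℕ i ℕ.+ toℕ j))
    Q : Matrix n
    Q r c = convolve (toℕ r) (λ t → a (suc (toℕ c ℕ.+ t))) f
    coef₂ : Fin n → Fin n → ℤ
    coef₂ r s = truncateAt (toℕ r) (λ s → f (toℕ r ∸ s)) (toℕ s)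
    coef₂-upper : ∀ r s → toℕ r ≤ toℕ s → coef₂ r s ≡ 0ℤ
    coef₂-upper r s = truncateAt-≥ (λ s → f (toℕ r ∸ s))

length-filterᵇ-++ : ∀ {A : Set} (p : A → Bool) xs ys →
  length (filterᵇ p (xs ++ ys)) ≡ length (filterᵇ p xs) ℕ.+ length (filterᵇ p ys)
length-filterᵇ-++ p xs ys = trans (cong length (filter-++ (T? ∘ p) xs ys)) (length-++ (filterᵇ p xs))

length-filterᵇ-map : ∀ {A B : Set} (p : B → Bool) (f : A → B) xs →
  length (filterᵇ p (map f xs)) ≡ length (filterᵇ (p ∘ f) xs)
length-filterᵇ-map p f []       = refl
length-filterᵇ-map p f (x ∷ xs) with p (f x)
... | true  = cong suc (length-filterᵇ-map p f xs)
... | false = length-filterᵇ-map p f xs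

length-filterᵇ-cong : ∀ {A : Set} {p q : A → Bool} → p ≗ q → ∀ xs →
                      length (filterᵇ p xs) ≡ length (filterᵇ q xs)
length-filterᵇ-cong p≗q xs =
  cong length (filter-≐ (T? ∘ _) (T? ∘ _) ((λ {x} → subst T (p≗q x)) , (λ {x} → subst T (sym (p≗q x)))) xs)

countWords : ℕ → (List Bool → Bool) → ℕ
countWords L p = length (filterᵇ p (words L))

countWords-suc : ∀ L p →
  countWords (suc L) p ≡ countWords L (p ∘ (true ∷_)) ℕ.+ countWords L (p ∘ (false ∷_))
countWords-suc L p = trans (length-filterᵇ-++ p (map (true ∷_) (words L)) (map (false ∷_) (words L)))
  (cong₂ ℕ._+_ (length-filterᵇ-map p (true ∷_) (words L)) (length-filterᵇ-map p (false ∷_) (words L)))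

countWords-false : ∀ L → countWords L (const false) ≡ 0
countWords-false L = cong length (filter-none (T? ∘ const false) (All.universal (λ _ ()) (words L)))

countWords-guard : ∀ L g (p q : List Bool → Bool) →
  ℤ.+ countWords L (λ w → p w ∧ (g ∧ q w)) ≡ (if g then ℤ.+ countWords L (λ w → p w ∧ q w) else 0ℤ)
countWords-guard L true  p q = refl
countWords-guard L false p q =
  cong ℤ.+_ (trans (length-filterᵇ-cong (λ w → ∧-zeroʳ (p w)) (words L)) (countWords-false L))

-- walks bad accept h up L counts the step sequences of length L from height h (up: the previous step
-- was an up-step) that never go below 0, make no peak at a height where bad holds, and end in a state
-- accepted by accept.
walks : (ℕ → Bool) → (ℕ → Bool → Bool) → ℕ → Bool → ℕ → ℤ
walks bad accept h up zero          = if accept h up then 1ℤ else 0ℤ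
walks bad accept zero up (suc L)    = walks bad accept 1 true L
walks bad accept (suc h) up (suc L) =
  walks bad accept (suc (suc h)) true L + (if not up ∨ not (bad (suc h)) then walks bad accept h false L else 0ℤ)

atGround : ℕ → Bool → Bool
atGround h _ = h ℕ.≡ᵇ 0

module _ (bad : ℕ → Bool) where

  private
    goodPeaks : List ℕ → Bool
    goodPeaks = all (λ k → not (bad k))

  countWords-walks : ∀ h L →
    ℤ.+ countWords L (λ w → dyckFrom h w ∧ goodPeaks (peakHeights h w)) ≡ walks bad atGround h false L
  countWords-walks-afterUp : ∀ h L →
    ℤ.+ countWords L (λ w → dyckFrom (suc h) w ∧ goodPeaks (peakHeights h (true ∷ w)))
      ≡ walks bad atGround (suc h) true L

  countWords-walks zero    zero    = refl
  countWords-walks (suc h) zero    = refl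
  countWords-walks zero    (suc L) =
    trans (cong ℤ.+_ (countWords-suc L _))
      (trans (cong₂ _+_ (countWords-walks-afterUp zero L) (cong ℤ.+_ (countWords-false L)))
        (ℤₚ.+-identityʳ _))
  countWords-walks (suc h) (suc L) =
    trans (cong ℤ.+_ (countWords-suc L _)) (cong₂ _+_ (countWords-walks-afterUp (suc h) L) (countWords-walks h L))

  countWords-walks-afterUp h zero    = refl
  countWords-walks-afterUp h (suc L) =
    trans (cong ℤ.+_ (countWords-suc L _))
      (cong₂ _+_ (countWords-walks-afterUp (suc h) L)
        (trans (countWords-guard L (not (bad (suc h))) (dyckFrom h) (goodPeaks ∘ peakHeights h))
               (cong (λ x → if not (bad (suc h)) then x else 0ℤ) (countWords-walks h L))))

-- The inside P of an arch U P D is walked one level lower, with bad ∘ suc; it must end on its ground,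
-- and the closing D makes a peak at height 1 exactly when P is empty.
closesArch : (ℕ → Bool) → ℕ → Bool → Bool
closesArch bad h up = (h ℕ.≡ᵇ 0) ∧ (not up ∨ not (bad 1))

convolve-+ˡ : ∀ M (F F′ G : ℕ → ℤ) →
              convolve M (λ k → F k + F′ k) G ≡ convolve M F G + convolve M F′ G
convolve-+ˡ M F F′ G =
  trans (sum-cong-≗ {suc M} (λ i → ℤₚ.*-distribʳ-+ (G (M ∸ toℕ i)) (F (toℕ i)) (F′ (toℕ i))))
        (∑-distrib-+ {suc M} (λ i → F (toℕ i) * G (M ∸ toℕ i)) (λ i → F′ (toℕ i) * G (M ∸ toℕ i)))

convolve-ifˡ : ∀ M g (F G : ℕ → ℤ) →
               convolve M (λ k → if g then F k else 0ℤ) G ≡ (if g then convolve M F G else 0ℤ)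
convolve-ifˡ M true  F G = refl
convolve-ifˡ M false F G = sum-zero (suc M) (λ _ → refl)

if-*ˡ : ∀ g x → (if g then 1ℤ else 0ℤ) * x ≡ (if g then x else 0ℤ)
if-*ˡ true  x = ℤₚ.*-identityˡ x
if-*ˡ false x = refl

walks-firstReturn : ∀ bad M h up →
  walks bad atGround (suc h) up (suc M)
    ≡ convolve M (walks (bad ∘ suc) (closesArch bad) h up) (walks bad atGround 0 false)
walks-firstReturn bad zero zero up = unitˡ (if not up ∨ not (bad 1) then 1ℤ else 0ℤ)
  where
  unitˡ : ∀ x → 0ℤ + x ≡ x * 1ℤ + 0ℤ
  unitˡ = solve-∀
walks-firstReturn bad zero (suc h) up = trans (ℤₚ.+-identityˡ _) (if-eta (not up ∨ not (bad (suc (suc h)))))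
walks-firstReturn bad (suc M) zero up = begin
  walks bad atGround 2 true (suc M) + (if g then ground (suc M) else 0ℤ)
    ≡⟨ cong₂ _+_ (walks-firstReturn bad M 1 true) (sym (if-*ˡ g (ground (suc M)))) ⟩
  convolve M (arch 1 true) ground + (if g then 1ℤ else 0ℤ) * ground (suc M)
    ≡⟨ ℤₚ.+-comm (convolve M (arch 1 true) ground) _ ⟩
  (if g then 1ℤ else 0ℤ) * ground (suc M) + convolve M (arch 1 true) ground ∎
  where
  g : Bool
  g = not up ∨ not (bad 1)
  arch : ℕ → Bool → ℕ → ℤ
  arch = walks (bad ∘ suc) (closesArch bad)
  ground : ℕ → ℤ
  ground = walks bad atGround 0 false
walks-firstReturn bad (suc M) (suc h) up = begin
  walks bad atGround (3 ℕ.+ h) true (suc M) + (if g then walks bad atGround (suc h) false (suc M) else 0ℤ)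
    ≡⟨ cong₂ _+_ (walks-firstReturn bad M (2 ℕ.+ h) true)
                 (cong (λ x → if g then x else 0ℤ) (walks-firstReturn bad M h false)) ⟩
  convolve M (arch (2 ℕ.+ h) true) ground + (if g then convolve M (arch h false) ground else 0ℤ)
    ≡⟨ cong (convolve M (arch (2 ℕ.+ h) true) ground +_) (convolve-ifˡ M g (arch h false) ground) ⟨
  convolve M (arch (2 ℕ.+ h) true) ground + convolve M (λ k → if g then arch h false k else 0ℤ) ground
    ≡⟨ convolve-+ˡ M (arch (2 ℕ.+ h) true) (λ k → if g then arch h false k else 0ℤ) ground ⟨
  convolve M (arch (suc h) up ∘ suc) ground
    ≡⟨ ℤₚ.+-identityˡ _ ⟨
  0ℤ + convolve M (arch (suc h) up ∘ suc) ground ∎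
  where
  g : Bool
  g = not up ∨ not (bad (2 ℕ.+ h))
  arch : ℕ → Bool → ℕ → ℤ
  arch = walks (bad ∘ suc) (closesArch bad)
  ground : ℕ → ℤ
  ground = walks bad atGround 0 false

double : ℕ → ℕ
double zero    = zero
double (suc n) = suc (suc (double n))

double≡+ : ∀ n → double n ≡ n ℕ.+ n
double≡+ zero    = refl
double≡+ (suc n) = cong suc (trans (cong suc (double≡+ n)) (sym (ℕₚ.+-suc n n)))

walks-oddLength : ∀ bad accept → (∀ h up → accept (suc h) up ≡ false) →
                  ∀ L h up k → h ℕ.+ L ≡ suc (double k) → walks bad accept h up L ≡ 0ℤ
walks-oddLength bad accept onlyAtGround zero (suc h) up k _ =
  cong (λ b → if b then 1ℤ else 0ℤ) (onlyAtGround h up)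
walks-oddLength bad accept onlyAtGround (suc L) zero up k odd =
  walks-oddLength bad accept onlyAtGround L 1 true k odd
walks-oddLength bad accept onlyAtGround (suc L) (suc h) up k odd = begin
  walks bad accept (2 ℕ.+ h) true L + (if g then walks bad accept h false L else 0ℤ)
    ≡⟨ cong₂ _+_ (walks-oddLength bad accept onlyAtGround L (2 ℕ.+ h) true k
                   (trans (cong suc (sym (ℕₚ.+-suc h L))) odd))
                 (cong (λ x → if g then x else 0ℤ)
                       (afterDown k (trans (sym (ℕₚ.+-suc h L)) (ℕₚ.suc-injective odd)))) ⟩
  0ℤ + (if g then 0ℤ else 0ℤ)
    ≡⟨ trans (ℤₚ.+-identityˡ _) (if-eta g) ⟩
  0ℤ ∎
  where
  g : Bool
  g = not up ∨ not (bad (suc h))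
  afterDown : ∀ k → suc (h ℕ.+ L) ≡ double k → walks bad accept h false L ≡ 0ℤ
  afterDown (suc k) even = walks-oddLength bad accept onlyAtGround L h false k (ℕₚ.suc-injective even)

walks-closesArch-down : ∀ bad bad′ L h →
                        walks bad′ (closesArch bad) h false L ≡ walks bad′ atGround h false L
walks-closesArch-raised : ∀ bad bad′ L h up →
                          walks bad′ (closesArch bad) (suc h) up L ≡ walks bad′ atGround (suc h) up L
walks-closesArch-down bad bad′ zero    zero    = refl
walks-closesArch-down bad bad′ zero    (suc h) = refl
walks-closesArch-down bad bad′ (suc L) zero    = walks-closesArch-raised bad bad′ L 0 true
walks-closesArch-down bad bad′ (suc L) (suc h) = walks-closesArch-raised bad bad′ (suc L) h false
walks-closesArch-raised bad bad′ zero    h up = refl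
walks-closesArch-raised bad bad′ (suc L) h up =
  cong₂ (λ x y → x + (if not up ∨ not (bad′ (suc h)) then y else 0ℤ))
        (walks-closesArch-raised bad bad′ L (suc h) true) (walks-closesArch-down bad bad′ L h)

walks-cong : ∀ {bad bad′} accept → (∀ k → bad (suc k) ≡ bad′ (suc k)) →
             ∀ L h up → walks bad accept h up L ≡ walks bad′ accept h up L
walks-cong accept bad≈bad′ zero    h       up = refl
walks-cong accept bad≈bad′ (suc L) zero    up = walks-cong accept bad≈bad′ L 1 true
walks-cong accept bad≈bad′ (suc L) (suc h) up =
  cong₂ _+_ (walks-cong accept bad≈bad′ L (suc (suc h)) true)
            (cong₂ (λ b x → if not up ∨ not b then x else 0ℤ)
                   (bad≈bad′ h) (walks-cong accept bad≈bad′ L h false))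

convolve-double : ∀ N (F G : ℕ → ℤ) → (∀ k → F (suc (double k)) ≡ 0ℤ) →
                  convolve (double N) F G ≡ convolve N (F ∘ double) (G ∘ double)
convolve-double zero    F G F-odd = refl
convolve-double (suc N) F G F-odd = cong (F 0 * G (double (suc N)) +_) (begin
  F 1 * G (suc (double N)) + convolve (double N) (F ∘ suc ∘ suc) G
    ≡⟨ cong (λ x → x * G (suc (double N)) + convolve (double N) (F ∘ suc ∘ suc) G) (F-odd 0) ⟩
  0ℤ + convolve (double N) (F ∘ suc ∘ suc) G
    ≡⟨ ℤₚ.+-identityˡ _ ⟩
  convolve (double N) (F ∘ suc ∘ suc) G
    ≡⟨ convolve-double N (F ∘ suc ∘ suc) G (F-odd ∘ suc) ⟩
  convolve N (F ∘ double ∘ suc) (G ∘ double) ∎)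

dyckAvoiding : (ℕ → Bool) → ℕ → ℕ
dyckAvoiding bad n = countWords (n ℕ.+ n) (λ w → dyckFrom 0 w ∧ all (λ h → not (bad h)) (peakHeights 0 w))

arches : (ℕ → Bool) → ℕ → ℤ
arches bad k = walks (bad ∘ suc) (closesArch bad) 0 true (double k)

dyckAvoiding-walks : ∀ bad n → ℤ.+ dyckAvoiding bad n ≡ walks bad atGround 0 false (double n)
dyckAvoiding-walks bad n =
  trans (countWords-walks bad 0 (n ℕ.+ n)) (cong (walks bad atGround 0 false) (sym (double≡+ n)))

dyckAvoiding-firstReturn : ∀ bad N →
  ℤ.+ dyckAvoiding bad (suc N) ≡ convolve N (arches bad) (ℤ.+_ ∘ dyckAvoiding bad)
dyckAvoiding-firstReturn bad N = begin
  ℤ.+ dyckAvoiding bad (suc N)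
    ≡⟨ dyckAvoiding-walks bad (suc N) ⟩
  walks bad atGround 1 true (suc (double N))
    ≡⟨ walks-firstReturn bad (double N) 0 true ⟩
  convolve (double N) (walks (bad ∘ suc) (closesArch bad) 0 true) (walks bad atGround 0 false)
    ≡⟨ convolve-double N (walks (bad ∘ suc) (closesArch bad) 0 true) (walks bad atGround 0 false)
         (λ k → walks-oddLength (bad ∘ suc) (closesArch bad) (λ _ _ → refl) _ 0 true k refl) ⟩
  convolve N (arches bad) (walks bad atGround 0 false ∘ double)
    ≡⟨ sum-cong-≗ {suc N} (λ k → cong (arches bad (toℕ k) *_) (dyckAvoiding-walks bad (N ∸ toℕ k))) ⟨
  convolve N (arches bad) (ℤ.+_ ∘ dyckAvoiding bad) ∎

arches-suc : ∀ bad k → arches bad (suc k) ≡ ℤ.+ dyckAvoiding (bad ∘ suc) (suc k)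
arches-suc bad k = trans (walks-closesArch-raised bad (bad ∘ suc) (suc (double k)) 0 true)
                         (sym (dyckAvoiding-walks (bad ∘ suc) (suc k)))

dyckAvoiding-cong : ∀ {bad bad′} → (∀ k → bad (suc k) ≡ bad′ (suc k)) →
                    ∀ n → ℤ.+ dyckAvoiding bad n ≡ ℤ.+ dyckAvoiding bad′ n
dyckAvoiding-cong {bad} {bad′} bad≈bad′ n = begin
  ℤ.+ dyckAvoiding bad n                 ≡⟨ dyckAvoiding-walks bad n ⟩
  walks bad atGround 0 false (double n)  ≡⟨ walks-cong atGround bad≈bad′ (double n) 0 false ⟩
  walks bad′ atGround 0 false (double n) ≡⟨ dyckAvoiding-walks bad′ n ⟨
  ℤ.+ dyckAvoiding bad′ n                ∎

T-ext : ∀ {x y} → (T x → T y) → (T y → T x) → x ≡ y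
T-ext x⇒y y⇒x = ⇔→≡ (mk⇔ (to T-≡ ∘ x⇒y ∘ from T-≡) (to T-≡ ∘ y⇒x ∘ from T-≡))
  where open Equivalence

any-allFin⁺ : ∀ {m} (p : Fin m → Bool) j → T (p j) → T (any p (allFin m))
any-allFin⁺ p j pj = any⁺ p (lose (∈-allFin j) pj)

any-allFin⁻ : ∀ {m} (p : Fin m → Bool) → T (any p (allFin m)) → ∃ λ j → T (p j)
any-allFin⁻ {m} p t = satisfied (any⁻ p (allFin m) t)

%-suc-cong : ∀ m .{{_ : NonZero m}} {a b} → a % m ≡ b % m → suc a % m ≡ suc b % m
%-suc-cong m {a} {b} a≡b = begin
  suc a % m                ≡⟨ %-distribˡ-+ 1 a m ⟩
  (1 % m ℕ.+ a % m) % m    ≡⟨ cong (λ x → (1 % m ℕ.+ x) % m) a≡b ⟩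
  (1 % m ℕ.+ b % m) % m    ≡⟨ %-distribˡ-+ 1 b m ⟨
  suc b % m                ∎

inModSet-shiftDown : ∀ m .{{_ : NonZero m}} (V : Subset m) k →
                     inModSet m (shiftDown m V) (suc k) ≡ inModSet m V (suc (suc k))
inModSet-shiftDown m V k = T-ext toV fromV
  where
  congruentTo : ℕ → Fin m → Bool
  congruentTo x j = lookup V j ∧ ((x % m) ≡ᵇ (elt j % m))
  shifted : Fin m → Bool
  shifted i = any (congruentTo (suc (elt i))) (allFin m)
  congruentToShifted : Fin m → Bool
  congruentToShifted i = lookup (shiftDown m V) i ∧ ((suc k % m) ≡ᵇ (elt i % m))
  residue : Fin m
  residue = fromℕ< (m%n<n k m)
  residue≡ : elt residue % m ≡ suc k % m
  residue≡ = %-suc-cong m (trans (cong (_% m) (Finₚ.toℕ-fromℕ< (m%n<n k m))) (m%n%n≡m%n k m))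
  toV : T (inModSet m (shiftDown m V) (suc k)) → T (inModSet m V (suc (suc k)))
  toV t =
    let (i , tᵢ)          = any-allFin⁻ congruentToShifted t
        (inShifted , k≡i) = Equivalence.to T-∧ tᵢ
        (j , tⱼ)          = any-allFin⁻ (congruentTo (suc (elt i)))
                              (subst T (lookup∘tabulate shifted i) inShifted)
        (j∈V , i≡j)       = Equivalence.to T-∧ tⱼ
    in any-allFin⁺ (congruentTo (suc (suc k))) j (Equivalence.from T-∧ (j∈V , ℕₚ.≡⇒≡ᵇ _ _
         (trans (%-suc-cong m (ℕₚ.≡ᵇ⇒≡ _ _ k≡i)) (ℕₚ.≡ᵇ⇒≡ _ _ i≡j))))
  fromV : T (inModSet m V (suc (suc k))) → T (inModSet m (shiftDown m V) (suc k))
  fromV t =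
    let (j , tⱼ)    = any-allFin⁻ (congruentTo (suc (suc k))) t
        (j∈V , k≡j) = Equivalence.to T-∧ tⱼ
        inShifted   = subst T (sym (lookup∘tabulate shifted residue))
                        (any-allFin⁺ (congruentTo (suc (elt residue))) j
                          (Equivalence.from T-∧ (j∈V , ℕₚ.≡⇒≡ᵇ _ _
                            (trans (%-suc-cong m residue≡) (ℕₚ.≡ᵇ⇒≡ _ _ k≡j)))))
    in any-allFin⁺ congruentToShifted residue
         (Equivalence.from T-∧ (inShifted , ℕₚ.≡⇒≡ᵇ _ _ (sym residue≡)))

lemma2p4 : (m : ℕ) .{{_ : NonZero m}} → 2 ≤ m → (V : Subset m) → (n : ℕ) → 2 ≤ n →
    hankel 0 n (D m V) ≡ hankel 1 (n ∸ 1) (D m (shiftDown m V))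
lemma2p4 m _ V (suc n) _ = begin
  hankel 0 (suc n) (D m V)
    ≡⟨ hankel-1/[1-x*a] (D m V) (arches P) refl (dyckAvoiding-firstReturn P) n ⟩
  hankel 1 n (arches P)
    ≡⟨ det-cong n (λ i j → trans (arches-suc P (toℕ i ℕ.+ toℕ j))
                                 (dyckAvoiding-cong (sym ∘ inModSet-shiftDown m V) (suc (toℕ i ℕ.+ toℕ j)))) ⟩
  hankel 1 n (D m (shiftDown m V)) ∎
  where
  P : ℕ → Bool
  P = inModSet m V
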